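{- Let $k>1$ and $\ell>2$ be integers and let $\mathcal L$ be a mixed layout of $G(k,\ell)$. Then every edge $(a,b)$ of $G(k-1,\ell)$ has at most two stack-attachments in $\mathcal L$.
   Context: For $\ell\ge 1$, $G(1,\ell)$ is a single edge; for $k>1$, $G(k,\ell)$ is obtained from $G(k-1,\ell)$ by attaching $\ell$ new vertices to each edge of $G(k-1,\ell)$, where attaching a new vertex $u$ to an edge $(v,w)$ means adding $u$ and the edges $(u,v),(u,w)$; $u$ is then called an attachment of $(v,w)$. A linear order is a total order $\prec$ of the vertex set. Two independent edges $(u_1,v_1),(u_2,v_2)$ with $u_i\prec v_i$ cross if $u_1\prec u_2\prec v_1\prec v_2$ and nest if $u_1\prec u_2\prec v_2\prec v_1$. A stack is a set of pairwise non-crossing edges; a queue is a set of pairwise non-nested edges. A mixed layout consists of a linear order of the vertices and a partition of the edges into one stack and one queue; edges in the stack (queue) are stack-edges (queue-edges). An attachment $u$ of $(v,w)$ (a vertex of $G(k,\ell)$ attached to $(v,w)$ in the construction) is a stack-attachment if both $(u,v)$ and $(u,w)$ are stack-edges, a queue-attachment if both are queue-edges, and a mixed-attachment if one is a stack-edge and the other a queue-edge. -}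

module Defs where

open import Data.Nat using (ℕ)
open import Data.Nat as Nat using ()
open import Data.Fin using (Fin; zero; suc)
open import Data.Bool using (Bool; true; false)
open import Data.Empty using (⊥)
open import Data.Unit using (⊤; tt)
open import Data.Sum using (_⊎_; inj₁; inj₂)
open import Data.Product using (_×_; _,_; proj₁; proj₂; Σ; ∃; ∃-syntax)
open import Relation.Binary.PropositionalEquality using (_≡_)
open import Relation.Binary.Structures using (IsStrictTotalOrder)
open import Level using (0ℓ)
open import Relation.Binary.Core using (Rel)

-- The graph G(k, ℓ) is represented with index n = k - 1, i.e.
-- V ℓ n / E ℓ n are the vertices / edges of G(n+1, ℓ).
--   G(n+2,ℓ): the vertices of G(n+1,ℓ) (inj₁) plus, for every edge e of
--   G(n+1,ℓ) and every i : Fin ℓ, a new vertex inj₂ (e , i), the i-th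
--   attachment of e.  Edges: the old edges (inj₁) plus, for every new
--   vertex (e , i), the two edges inj₂ (e , i , b) joining it to the
--   first (b = false) or second (b = true) endpoint of e.
mutual
  V : ℕ → ℕ → Set
  V ℓ Nat.zero = Fin 2
  V ℓ (Nat.suc n) = V ℓ n ⊎ (E ℓ n × Fin ℓ)

  E : ℕ → ℕ → Set
  E ℓ Nat.zero = ⊤
  E ℓ (Nat.suc n) = E ℓ n ⊎ (E ℓ n × Fin ℓ × Bool)

ends : (ℓ n : ℕ) → E ℓ n → V ℓ n × V ℓ n
ends ℓ Nat.zero tt = (zero , suc zero)
ends ℓ (Nat.suc n) (inj₁ e) = (inj₁ (proj₁ (ends ℓ n e)) , inj₁ (proj₂ (ends ℓ n e)))
ends ℓ (Nat.suc n) (inj₂ (e , i , false)) = (inj₂ (e , i) , inj₁ (proj₁ (ends ℓ n e)))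
ends ℓ (Nat.suc n) (inj₂ (e , i , true))  = (inj₂ (e , i) , inj₁ (proj₂ (ends ℓ n e)))

data Page : Set where
  stack queue : Page

record MixedLayout (ℓ n : ℕ) : Set₁ where
  field
    _≺_ : Rel (V ℓ n) 0ℓ
    isLinear : IsStrictTotalOrder _≡_ _≺_
    page : E ℓ n → Page

  Spans : E ℓ n → V ℓ n → V ℓ n → Set
  Spans e u v = ((u ≡ proj₁ (ends ℓ n e) × v ≡ proj₂ (ends ℓ n e))
                ⊎ (u ≡ proj₂ (ends ℓ n e) × v ≡ proj₁ (ends ℓ n e))) × u ≺ v

  -- e and f cross: u₁ ≺ u₂ ≺ v₁ ≺ v₂ (independence is implied by strictness)
  Cross : E ℓ n → E ℓ n → Set
  Cross e f = ∃[ u₁ ] ∃[ v₁ ] ∃[ u₂ ] ∃[ v₂ ]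
    (Spans e u₁ v₁ × Spans f u₂ v₂ × u₁ ≺ u₂ × u₂ ≺ v₁ × v₁ ≺ v₂)

  Nest : E ℓ n → E ℓ n → Set
  Nest e f = ∃[ u₁ ] ∃[ v₁ ] ∃[ u₂ ] ∃[ v₂ ]
    (Spans e u₁ v₁ × Spans f u₂ v₂ × u₁ ≺ u₂ × u₂ ≺ v₂ × v₂ ≺ v₁)

  field
    stackOK : ∀ e f → page e ≡ stack → page f ≡ stack → Cross e f → ⊥
    queueOK : ∀ e f → page e ≡ queue → page f ≡ queue → Nest e f → ⊥

StackAttachment : {ℓ m : ℕ} → MixedLayout ℓ (Nat.suc m) → E ℓ m → Fin ℓ → Set
StackAttachment L e i =
  (MixedLayout.page L (inj₂ (e , i , false)) ≡ stack) ×
  (MixedLayout.page L (inj₂ (e , i , true)) ≡ stack)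

-- Let a ≺ b be the ends of the edge and call a vertex joined to both a and b by
-- stack-edges a common stack-neighbour.  Two common stack-neighbours u ≺ v left of
-- a give crossing stack-edges (u,a) and (v,b); symmetrically at most one lies
-- right of b and at most one between a and b (there (a,v) crosses (u,b)).  One left
-- of a and one right of b are also impossible, since (x,b) crosses (a,z).  So at
-- most two of the three regions are occupied, each by at most one vertex.
module Submission where

open import Defs
open import Data.Nat using (ℕ; zero; suc; _<_)
open import Data.Fin using (Fin)
open import Data.Bool using (true; false)
open import Data.Empty using (⊥; ⊥-elim)
open import Data.Unit using (tt)
open import Data.Sum using (_⊎_; inj₁; inj₂)
open import Data.Sum.Properties using (inj₁-injective; inj₂-injective)
open import Data.Product using (_×_; _,_; proj₁; proj₂; ∃-syntax)
open import Data.Product.Properties using (,-injectiveʳ)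
open import Function using (_∘_; _∋_)
open import Level using (0ℓ)
open import Relation.Binary.Core using (Rel)
open import Relation.Binary.Definitions using (Symmetric; tri<; tri≈; tri>)
open import Relation.Binary.PropositionalEquality using (_≡_; _≢_; refl)
open import Relation.Binary.Structures using (IsStrictTotalOrder)
open import Relation.Nullary using (¬_)

module NonCrossingGraph
  {X : Set} {_≺_ : Rel X 0ℓ} (isStrictTotalOrder : IsStrictTotalOrder _≡_ _≺_)
  (_~_ : Rel X 0ℓ) (~-sym : Symmetric _~_)
  (~-noncrossing : ∀ {p q r s} → p ~ r → q ~ s → p ≺ q → q ≺ r → r ≺ s → ⊥)
  where

  open IsStrictTotalOrder isStrictTotalOrder using (compare)

  CommonNeighbour : X → X → X → Set
  CommonNeighbour a b u = u ~ a × u ~ b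

  swap-commonNeighbour : ∀ {a b u} → CommonNeighbour a b u → CommonNeighbour b a u
  swap-commonNeighbour (ua , ub) = ub , ua

  data Region : Set where
    left middle right : Region

  data Position (a b u : X) : Region → Set where
    left   : u ≺ a → Position a b u left
    middle : a ≺ u → u ≺ b → Position a b u middle
    right  : b ≺ u → Position a b u right

  Apart : X → X → X → Set
  Apart a b u = u ≢ a × u ≢ b

  position : ∀ {a b u} → Apart a b u → ∃[ r ] Position a b u r
  position {a} {b} {u} (u≢a , u≢b) with compare u a
  ... | tri< u≺a _ _ = left , left u≺a
  ... | tri≈ _ u≡a _ = ⊥-elim (u≢a u≡a)
  ... | tri> _ _ a≺u with compare u b
  ...   | tri< u≺b _ _ = middle , middle a≺u u≺b
  ...   | tri≈ _ u≡b _ = ⊥-elim (u≢b u≡b)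
  ...   | tri> _ _ b≺u = right , right b≺u

  data Separated : Region → Region → Set where
    left-middle  : Separated left middle
    middle-left  : Separated middle left
    middle-right : Separated middle right
    right-middle : Separated right middle

  no-three-pairwise-separated :
    ∀ {r s t} → Separated r s → Separated r t → Separated s t → ⊥
  no-three-pairwise-separated left-middle left-middle ()
  no-three-pairwise-separated middle-left middle-left ()
  no-three-pairwise-separated middle-left middle-right ()
  no-three-pairwise-separated middle-right middle-left ()
  no-three-pairwise-separated middle-right middle-right ()
  no-three-pairwise-separated right-middle right-middle ()

  module _ {a b : X} (a≺b : a ≺ b) where

    commonNeighbours-separated :
      ∀ {u v r s} → u ≢ v → CommonNeighbour a b u → CommonNeighbour a b v →
      Position a b u r → Position a b v s → Separated r s
    commonNeighbours-separated {u} {v} u≢v (ua , ub) (va , vb) pu pv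
      with pu | pv | compare u v
    ... | _ | _ | tri≈ _ u≡v _ = ⊥-elim (u≢v u≡v)
    ... | left u≺a | left v≺a | tri< u≺v _ _ = ⊥-elim (~-noncrossing ua vb u≺v v≺a a≺b)
    ... | left u≺a | left v≺a | tri> _ _ v≺u = ⊥-elim (~-noncrossing va ub v≺u u≺a a≺b)
    ... | left _ | middle _ _ | _ = left-middle
    ... | left u≺a | right b≺v | _ = ⊥-elim (~-noncrossing ub (~-sym va) u≺a a≺b b≺v)
    ... | middle _ _ | left _ | _ = middle-left
    ... | middle a≺u _ | middle _ v≺b | tri< u≺v _ _ =
      ⊥-elim (~-noncrossing (~-sym va) ub a≺u u≺v v≺b)
    ... | middle _ u≺b | middle a≺v _ | tri> _ _ v≺u =
      ⊥-elim (~-noncrossing (~-sym ua) vb a≺v v≺u u≺b)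
    ... | middle _ _ | right _ | _ = middle-right
    ... | right b≺u | left v≺a | _ = ⊥-elim (~-noncrossing vb (~-sym ua) v≺a a≺b b≺u)
    ... | right _ | middle _ _ | _ = right-middle
    ... | right b≺u | right _ | tri< u≺v _ _ =
      ⊥-elim (~-noncrossing (~-sym ua) (~-sym vb) a≺b b≺u u≺v)
    ... | right _ | right b≺v | tri> _ _ v≺u =
      ⊥-elim (~-noncrossing (~-sym va) (~-sym ub) a≺b b≺v v≺u)

    no-three-commonNeighbours-≺ :
      ∀ {u v w} → u ≢ v → u ≢ w → v ≢ w → Apart a b u → Apart a b v → Apart a b w →
      ¬ (CommonNeighbour a b u × CommonNeighbour a b v × CommonNeighbour a b w)
    no-three-commonNeighbours-≺ u≢v u≢w v≢w apart-u apart-v apart-w (cu , cv , cw)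
      with position apart-u | position apart-v | position apart-w
    ... | _ , pu | _ , pv | _ , pw = no-three-pairwise-separated
      (commonNeighbours-separated u≢v cu cv pu pv)
      (commonNeighbours-separated u≢w cu cw pu pw)
      (commonNeighbours-separated v≢w cv cw pv pw)

  no-three-commonNeighbours :
    ∀ {a b u v w} → a ≢ b → u ≢ v → u ≢ w → v ≢ w →
    Apart a b u → Apart a b v → Apart a b w →
    ¬ (CommonNeighbour a b u × CommonNeighbour a b v × CommonNeighbour a b w)
  no-three-commonNeighbours {a} {b} a≢b u≢v u≢w v≢w au av aw (cu , cv , cw) with compare a b
  ... | tri< a≺b _ _ = no-three-commonNeighbours-≺ a≺b u≢v u≢w v≢w au av aw (cu , cv , cw)
  ... | tri≈ _ a≡b _ = a≢b a≡b
  ... | tri> _ _ b≺a = no-three-commonNeighbours-≺ b≺a u≢v u≢w v≢w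
    (swap-apart au) (swap-apart av) (swap-apart aw)
    (swap-commonNeighbour cu , swap-commonNeighbour cv , swap-commonNeighbour cw)
    where
    swap-apart : ∀ {x} → Apart a b x → Apart b a x
    swap-apart (x≢a , x≢b) = x≢b , x≢a

ends-distinct : ∀ ℓ n (e : E ℓ n) → proj₁ (ends ℓ n e) ≢ proj₂ (ends ℓ n e)
ends-distinct ℓ zero tt ()
ends-distinct ℓ (suc n) (inj₁ e) = ends-distinct ℓ n e ∘ inj₁-injective
ends-distinct ℓ (suc n) (inj₂ (e , i , false)) ()
ends-distinct ℓ (suc n) (inj₂ (e , i , true)) ()

module StackGraph {ℓ n : ℕ} (L : MixedLayout ℓ n) where
  open MixedLayout L
  open IsStrictTotalOrder isLinear using (trans)

  Joins : E ℓ n → V ℓ n → V ℓ n → Set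
  Joins f u v = (u ≡ proj₁ (ends ℓ n f) × v ≡ proj₂ (ends ℓ n f))
              ⊎ (u ≡ proj₂ (ends ℓ n f) × v ≡ proj₁ (ends ℓ n f))

  StackAdjacent : Rel (V ℓ n) 0ℓ
  StackAdjacent u v = ∃[ f ] page f ≡ stack × Joins f u v

  stackAdjacent-sym : Symmetric StackAdjacent
  stackAdjacent-sym (f , f-stack , inj₁ (u≡ , v≡)) = f , f-stack , inj₂ (v≡ , u≡)
  stackAdjacent-sym (f , f-stack , inj₂ (u≡ , v≡)) = f , f-stack , inj₁ (v≡ , u≡)

  stackAdjacent-noncrossing :
    ∀ {p q r s} → StackAdjacent p r → StackAdjacent q s → p ≺ q → q ≺ r → r ≺ s → ⊥
  stackAdjacent-noncrossing (f , f-stack , f-pr) (g , g-stack , g-qs) p≺q q≺r r≺s =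
    stackOK f g f-stack g-stack
      (_ , _ , _ , _ , (f-pr , trans p≺q q≺r) , (g-qs , trans q≺r r≺s) , p≺q , q≺r , r≺s)

  open NonCrossingGraph isLinear StackAdjacent stackAdjacent-sym stackAdjacent-noncrossing public

module _ {ℓ m : ℕ} (L : MixedLayout ℓ (suc m)) (e : E ℓ m) where
  open StackGraph L

  stackAttachment⇒commonNeighbour :
    ∀ {i} → StackAttachment L e i →
    CommonNeighbour (inj₁ (proj₁ (ends ℓ m e))) (inj₁ (proj₂ (ends ℓ m e))) (inj₂ (e , i))
  stackAttachment⇒commonNeighbour {i} (first-stack , second-stack) =
    (inj₂ (e , i , false) , first-stack , inj₁ (refl , refl)) ,
    (inj₂ (e , i , true) , second-stack , inj₁ (refl , refl))

  attachment-apart :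
    ∀ i → Apart (inj₁ (proj₁ (ends ℓ m e))) (inj₁ (proj₂ (ends ℓ m e))) (inj₂ (e , i))
  attachment-apart i = (λ ()) , (λ ())

attachment-injective : ∀ {ℓ m} {e : E ℓ m} {i j : Fin ℓ} →
                       i ≢ j → (V ℓ (suc m) ∋ inj₂ (e , i)) ≢ inj₂ (e , j)
attachment-injective i≢j = i≢j ∘ ,-injectiveʳ ∘ inj₂-injective

lemma1 : (ℓ : ℕ) → 2 < ℓ → (m : ℕ) → (L : MixedLayout ℓ (suc m)) → (e : E ℓ m) →
         (i j k : Fin ℓ) → i ≢ j → i ≢ k → j ≢ k →
         ¬ (StackAttachment L e i × StackAttachment L e j × StackAttachment L e k)
lemma1 ℓ _ m L e i j k i≢j i≢k j≢k (si , sj , sk) =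
  StackGraph.no-three-commonNeighbours L
    (ends-distinct ℓ m e ∘ inj₁-injective)
    (attachment-injective i≢j) (attachment-injective i≢k) (attachment-injective j≢k)
    (attachment-apart L e i) (attachment-apart L e j) (attachment-apart L e k)
    (commonNeighbour si , commonNeighbour sj , commonNeighbour sk)
  where
  commonNeighbour = stackAttachment⇒commonNeighbour L e
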